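{- Let $b\ge 2$ and $d\ge1$ be integers and let $a_1,\dots,a_d$ be positive integers coprime to $b$. Then \[(I-T^{a_d})\,S_{(a_1,\dots,a_d;b)}=S_{(a_1,\dots,a_{d-1};b)}\] and \[S_{(a_1,\dots,a_d;b)}=S_{(a_1;b)}*S_{(a_2;b)}*\cdots*S_{(a_d;b)}.\]
   Context: For $b\ge2$, $\xi_b=e^{2\pi i/b}$ and positive integers $a_i$ coprime to $b$, the Fourier–Dedekind sum is $S_{(a_1,\dots,a_d;b)}(n)=\frac1b\sum_{j=1}^{b-1}\frac{\xi_b^{jn}}{(1-\xi_b^{ja_1})\cdots(1-\xi_b^{ja_d})}$, a $b$-periodic function of $n\in\mathbb{Z}$; for $d=1$ the right side of the first identity is the $0$-dimensional sum $S_{(\,;b)}(n)=S_b(n):=\frac1b\sum_{j=1}^{b-1}\xi_b^{jn}$. $I$ is the identity operator, $(T^a h)(t)=h(t+a)$, and for $b$-periodic $f,g$, $(f*g)(t)=\sum_{m=0}^{b-1}f(t-m)g(m)$. -}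

module Defs where

open import Level using (Level; _⊔_) renaming (suc to lsuc)
open import Algebra.Bundles using (CommutativeRing)
open import Data.Nat using (ℕ; zero; suc; _<_; _≤_) renaming (_*_ to _*ℕ_)
open import Data.Integer using (ℤ; +_; -[1+_]) renaming (_+_ to _+ℤ_; _-_ to _-ℤ_; _*_ to _*ℤ_)
open import Data.Vec using (Vec; []; _∷_; foldr₁; map)
open import Relation.Nullary using (¬_)

record Field (c ℓ : Level) : Set (lsuc (c ⊔ ℓ)) where
  field
    commutativeRing : CommutativeRing c ℓ
  open CommutativeRing commutativeRing public
  field
    _⁻¹     : Carrier → Carrier
    inverse : ∀ x → ¬ (x ≈ 0#) → (x * (x ⁻¹)) ≈ 1#
    0≉1     : ¬ (0# ≈ 1#)

module FieldOps {c ℓ : Level} (F : Field c ℓ) where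
  open Field F

  pow : Carrier → ℕ → Carrier
  pow x zero    = 1#
  pow x (suc n) = x * pow x n

  zpow : Carrier → ℤ → Carrier
  zpow x (+ n)     = pow x n
  zpow x -[1+ n ]  = (pow x (suc n)) ⁻¹

  ℕ→F : ℕ → Carrier
  ℕ→F zero    = 0#
  ℕ→F (suc n) = 1# + ℕ→F n

  sumBelow : ℕ → (ℕ → Carrier) → Carrier
  sumBelow zero    f = 0#
  sumBelow (suc n) f = f n + sumBelow n f

  prodVec : {d : ℕ} → Vec Carrier d → Carrier
  prodVec []       = 1#
  prodVec (x ∷ xs) = x * prodVec xs


IsPrimitiveRoot : {c ℓ : Level} (F : Field c ℓ) → ℕ → Field.Carrier F → Set ℓ
IsPrimitiveRoot F b ζ =
  (pow ζ b ≈ 1#) × (∀ k → 1 ≤ k → k < b → ¬ (pow ζ k ≈ 1#))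
  where
    open Field F
    open FieldOps F
    open import Data.Product using (_×_)

module FourierDedekind {c ℓ : Level} (F : Field c ℓ) (ζ : Field.Carrier F) (b : ℕ) where
  open Field F
  open FieldOps F

  -- Fourier–Dedekind sum  S_{(a_1,…,a_d;b)}(n)
  --   = (1/b) Σ_{j=1}^{b-1} ζ^{jn} / ∏_i (1 - ζ^{j a_i})
  S : {d : ℕ} → Vec ℕ d → ℤ → Carrier
  S as n = (ℕ→F b ⁻¹) * sumBelow (b Data.Nat.∸ 1) term
    where
      term : ℕ → Carrier
      term k = let j = suc k in
        zpow ζ ((+ j) *ℤ n) * (prodVec (map (λ a → 1# - pow ζ (j *ℕ a)) as) ⁻¹)

  IminusT : ℕ → (ℤ → Carrier) → (ℤ → Carrier)
  IminusT a h t = h t - h (t +ℤ (+ a))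

  -- convolution of b-periodic functions: (f * g)(t) = Σ_{m=0}^{b-1} f(t-m) g(m)
  _⊛_ : (ℤ → Carrier) → (ℤ → Carrier) → (ℤ → Carrier)
  (f ⊛ g) t = sumBelow b (λ m → f (t -ℤ (+ m)) * g (+ m))

  -- S_{(a_1;b)} * S_{(a_2;b)} * ⋯ * S_{(a_d;b)}  (bracketed to the right)
  convS : {d : ℕ} → Vec ℕ (suc d) → (ℤ → Carrier)
  convS as = foldr₁ _⊛_ (map (λ a → S (a ∷ [])) as)

  _≋_ : (ℤ → Carrier) → (ℤ → Carrier) → Set ℓ
  f ≋ g = ∀ n → f n ≈ g n

module Submission where

-- Write e(x) = ζ^x for x ∈ ℤ and, for coefficients c indexed by the frequencies
-- 1 ≤ J < b,  series c x = (1/b) Σ_J ζ^{Jx} c_J.  Then S_{(a_1,…,a_d;b)} is, by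
-- definition, the series with coefficients 1 / ∏_i (1 - ζ^{J a_i}).  Two facts about
-- series give the theorem:
--   * (I - T^a) multiplies the J-th coefficient by 1 - ζ^{Ja}; cancelling this factor
--     against the last factor of the denominator gives the difference equation;
--   * the convolution of two series multiplies their coefficients (orthogonality of
--     the characters m ↦ ζ^{Jm} over m < b); splitting off the first factor of the
--     denominator and inducting on d gives the convolution decomposition.
-- Dividing by b requires b ≉ 0 in F.  This holds because F has a primitive b-th root
-- of unity: a prime p ∣ b vanishing in F would, via the Frobenius identity
-- (y + 1)^p = y^p + 1, force ζ^{b/p} = 1.  The file develops, in order: field algebra
-- and finite sums, binomial coefficients at primes, the characteristic argument,
-- roots of unity with integer exponents, finite Fourier series, and the theorem.

open import Defs
open import Data.Nat as ℕ using (ℕ; zero; suc; _≤_; _≥_; _!)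
import Data.Nat.Properties as ℕP
open import Data.Nat.Coprimality as Coprimality using (Coprime; coprime-divisor)
open import Data.Nat.Divisibility using (_∣_; divides; ∣1⇒≡1; ∣⇒≤; m∣m*n; n∣m*n; ∣-trans; ∣-refl; m%n≡0⇒n∣m)
open import Data.Nat.DivMod using (_/_; _%_; m/n*n≡m; m≡m%n+[m/n]*n; m%n<n)
open import Data.Nat.Primality using (Prime; euclidsLemma; ¬prime[0]; ¬prime[1]; prime⇒nonTrivial)
open import Data.Nat.Primality.Factorisation using (factorise; PrimeFactorisation)
open import Data.Nat.ListAction using (product)
open import Data.Nat.Combinatorics using (_C_; nCk≡n!/k![n-k]!; k![n∸k]!∣n!; nCn≡1; nCk≡nC[n∸k])
open import Data.Integer as ℤ using (ℤ; +_; -[1+_])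
import Data.Integer.Properties as ℤP
open import Data.Fin using (toℕ; fromℕ; inject₁) renaming (suc to fsuc)
open import Data.Fin.Properties using (toℕ<n; toℕ-fromℕ; toℕ-inject₁)
open import Data.List using ([]; _∷_)
open import Data.List.Relation.Unary.All as ListAll using ([]; _∷_)
open import Data.Vec using (Vec; []; _∷_; map; init; last)
open import Data.Vec.Relation.Unary.All as All using (All; []; _∷_)
open import Data.Product using (_×_; _,_; proj₁; proj₂; Σ-syntax)
open import Data.Sum using (inj₁; inj₂)
open import Data.Empty using (⊥-elim)
open import Relation.Nullary using (¬_; yes; no)
import Relation.Binary.PropositionalEquality as P
open P using (_≡_)
import Algebra.Properties.AbelianGroup as AbelianGroupProperties
import Algebra.Properties.CommutativeSemigroup as CommSemigroupProperties

module FieldAlgebra {c ℓ} (F : Field c ℓ) where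
  open Field F
  open FieldOps F
  open import Relation.Binary.Reasoning.Setoid setoid
  open import Algebra.Properties.Ring ring public using (x[y-z]≈xy-xz)
  open import Algebra.Properties.AbelianGroup +-abelianGroup public
    using (⁻¹-∙-comm; x∙y⁻¹≈ε⇒x≈y; x≈y⇒x∙y⁻¹≈ε; //-rightDividesˡ; ∙-cancelʳ)
  module +P = CommSemigroupProperties +-commutativeSemigroup
  module *P = CommSemigroupProperties *-commutativeSemigroup

  1≉0 : ¬ (1# ≈ 0#)
  1≉0 e = 0≉1 (sym e)

  inverseˡ : ∀ {x} → ¬ (x ≈ 0#) → x ⁻¹ * x ≈ 1#
  inverseˡ {x} x≉0 = trans (*-comm _ _) (inverse x x≉0)

  cancel-nonzero : ∀ {x y} → ¬ (x ≈ 0#) → x * y ≈ 0# → y ≈ 0#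
  cancel-nonzero {x} {y} x≉0 xy≈0 = begin
    y              ≈⟨ sym (*-identityˡ y) ⟩
    1# * y         ≈⟨ *-congʳ (sym (inverseˡ x≉0)) ⟩
    (x ⁻¹ * x) * y ≈⟨ *-assoc _ _ _ ⟩
    x ⁻¹ * (x * y) ≈⟨ *-congˡ xy≈0 ⟩
    x ⁻¹ * 0#      ≈⟨ zeroʳ _ ⟩
    0#             ∎

  *-nonzero : ∀ {x y} → ¬ (x ≈ 0#) → ¬ (y ≈ 0#) → ¬ (x * y ≈ 0#)
  *-nonzero x≉0 y≉0 xy≈0 = y≉0 (cancel-nonzero x≉0 xy≈0)

  ⁻¹-unique : ∀ {x y} → x * y ≈ 1# → x ⁻¹ ≈ y
  ⁻¹-unique {x} {y} xy≈1 = begin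
    x ⁻¹                ≈⟨ sym (*-identityʳ _) ⟩
    x ⁻¹ * 1#           ≈⟨ *-congˡ (sym xy≈1) ⟩
    x ⁻¹ * (x * y)      ≈⟨ sym (*-assoc _ _ _) ⟩
    (x ⁻¹ * x) * y      ≈⟨ *-congʳ (inverseˡ x≉0) ⟩
    1# * y              ≈⟨ *-identityˡ y ⟩
    y                   ∎
    where
    x≉0 : ¬ (x ≈ 0#)
    x≉0 x≈0 = 0≉1 (trans (sym (zeroˡ y)) (trans (*-congʳ (sym x≈0)) xy≈1))

  ⁻¹-cong : ∀ {x y} → ¬ (x ≈ 0#) → x ≈ y → x ⁻¹ ≈ y ⁻¹
  ⁻¹-cong {x} x≉0 x≈y = sym (⁻¹-unique (trans (*-congʳ (sym x≈y)) (inverse x x≉0)))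

  ⁻¹-* : ∀ {x y} → ¬ (x ≈ 0#) → ¬ (y ≈ 0#) → (x * y) ⁻¹ ≈ x ⁻¹ * y ⁻¹
  ⁻¹-* {x} {y} x≉0 y≉0 = ⁻¹-unique (begin
    (x * y) * (x ⁻¹ * y ⁻¹) ≈⟨ *P.interchange x y (x ⁻¹) (y ⁻¹) ⟩
    (x * x ⁻¹) * (y * y ⁻¹) ≈⟨ *-cong (inverse x x≉0) (inverse y y≉0) ⟩
    1# * 1#                 ≈⟨ *-identityˡ 1# ⟩
    1#                      ∎)

  prodVec-init-last : ∀ {d} {A : Set} (f : A → Carrier) (xs : Vec A (suc d)) →
    prodVec (map f xs) ≈ prodVec (map f (init xs)) * f (last xs)
  prodVec-init-last f (x ∷ [])     = trans (*-identityʳ _) (sym (*-identityˡ _))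
  prodVec-init-last f (x ∷ y ∷ xs) = trans (*-congˡ (prodVec-init-last f (y ∷ xs))) (sym (*-assoc _ _ _))

  ≉⇒sub≉0 : ∀ {x y} → ¬ (x ≈ y) → ¬ (x - y ≈ 0#)
  ≉⇒sub≉0 x≉y x-y≈0 = x≉y (x∙y⁻¹≈ε⇒x≈y _ _ x-y≈0)

  telescope : ∀ x y z → (x - y) + (y - z) ≈ x - z
  telescope x y z = trans (sym (+-assoc _ _ _)) (+-congʳ (//-rightDividesˡ y x))

  [x-y]z≈xz-yz : ∀ x y z → (x - y) * z ≈ x * z - y * z
  [x-y]z≈xz-yz x y z = begin
    (x - y) * z     ≈⟨ *-comm _ _ ⟩
    z * (x - y)     ≈⟨ x[y-z]≈xy-xz z x y ⟩
    z * x - z * y   ≈⟨ +-cong (*-comm z x) (-‿cong (*-comm z y)) ⟩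
    x * z - y * z   ∎

  pow-cong : ∀ {x y} n → x ≈ y → pow x n ≈ pow y n
  pow-cong zero    x≈y = refl
  pow-cong (suc n) x≈y = *-cong x≈y (pow-cong n x≈y)

  pow-+ : ∀ x m n → pow x (m ℕ.+ n) ≈ pow x m * pow x n
  pow-+ x zero    n = sym (*-identityˡ _)
  pow-+ x (suc m) n = trans (*-congˡ (pow-+ x m n)) (sym (*-assoc _ _ _))

  pow-* : ∀ x m n → pow x (n ℕ.* m) ≈ pow (pow x m) n
  pow-* x m zero    = refl
  pow-* x m (suc n) = trans (pow-+ x m (n ℕ.* m)) (*-congˡ (pow-* x m n))

  pow-1# : ∀ n → pow 1# n ≈ 1#
  pow-1# zero    = refl
  pow-1# (suc n) = trans (*-identityˡ _) (pow-1# n)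

  pow-nonzero : ∀ {x} n → ¬ (x ≈ 0#) → ¬ (pow x n ≈ 0#)
  pow-nonzero zero    x≉0 = 1≉0
  pow-nonzero (suc n) x≉0 = *-nonzero x≉0 (pow-nonzero n x≉0)

  ℕ→F-+ : ∀ m n → ℕ→F (m ℕ.+ n) ≈ ℕ→F m + ℕ→F n
  ℕ→F-+ zero    n = sym (+-identityˡ _)
  ℕ→F-+ (suc m) n = trans (+-congˡ (ℕ→F-+ m n)) (sym (+-assoc _ _ _))

  ℕ→F-* : ∀ m n → ℕ→F (m ℕ.* n) ≈ ℕ→F m * ℕ→F n
  ℕ→F-* zero    n = sym (zeroˡ _)
  ℕ→F-* (suc m) n = begin
    ℕ→F (n ℕ.+ m ℕ.* n)         ≈⟨ ℕ→F-+ n (m ℕ.* n) ⟩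
    ℕ→F n + ℕ→F (m ℕ.* n)       ≈⟨ +-cong (sym (*-identityˡ _)) (ℕ→F-* m n) ⟩
    1# * ℕ→F n + ℕ→F m * ℕ→F n  ≈⟨ sym (distribʳ _ _ _) ⟩
    (1# + ℕ→F m) * ℕ→F n        ∎

  sum-cong : ∀ n {f g : ℕ → Carrier} → (∀ k → k ℕ.< n → f k ≈ g k) → sumBelow n f ≈ sumBelow n g
  sum-cong zero    f≈g = refl
  sum-cong (suc n) f≈g = +-cong (f≈g n ℕP.≤-refl) (sum-cong n (λ k k<n → f≈g k (ℕP.m<n⇒m<1+n k<n)))

  sum-+ : ∀ n (f g : ℕ → Carrier) → sumBelow n (λ k → f k + g k) ≈ sumBelow n f + sumBelow n g
  sum-+ zero    f g = sym (+-identityˡ 0#)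
  sum-+ (suc n) f g = trans (+-congˡ (sum-+ n f g)) (+P.interchange _ _ _ _)

  sum-sub : ∀ n (f g : ℕ → Carrier) → sumBelow n (λ k → f k - g k) ≈ sumBelow n f - sumBelow n g
  sum-sub zero    f g = sym (-‿inverseʳ 0#)
  sum-sub (suc n) f g = begin
    (f n - g n) + sumBelow n (λ k → f k - g k)      ≈⟨ +-congˡ (sum-sub n f g) ⟩
    (f n - g n) + (sumBelow n f - sumBelow n g)     ≈⟨ +P.interchange _ _ _ _ ⟩
    (f n + sumBelow n f) + (- g n + - sumBelow n g) ≈⟨ +-congˡ (⁻¹-∙-comm _ _) ⟩
    (f n + sumBelow n f) - (g n + sumBelow n g)     ∎

  *-sum : ∀ n x (f : ℕ → Carrier) → x * sumBelow n f ≈ sumBelow n (λ k → x * f k)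
  *-sum zero    x f = zeroʳ x
  *-sum (suc n) x f = trans (distribˡ x _ _) (+-congˡ (*-sum n x f))

  sum-* : ∀ n x (f : ℕ → Carrier) → sumBelow n f * x ≈ sumBelow n (λ k → f k * x)
  sum-* n x f = trans (*-comm _ _) (trans (*-sum n x f) (sum-cong n (λ k _ → *-comm _ _)))

  sum-*-sum : ∀ m n (f g : ℕ → Carrier) → sumBelow m f * sumBelow n g ≈ sumBelow m (λ i → sumBelow n (λ j → f i * g j))
  sum-*-sum m n f g = trans (sum-* m (sumBelow n g) f) (sum-cong m (λ i _ → *-sum n (f i) g))

  sum-zero : ∀ n (f : ℕ → Carrier) → (∀ k → k ℕ.< n → f k ≈ 0#) → sumBelow n f ≈ 0#
  sum-zero zero    f f≈0 = refl
  sum-zero (suc n) f f≈0 =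
    trans (+-cong (f≈0 n ℕP.≤-refl) (sum-zero n f (λ k k<n → f≈0 k (ℕP.m<n⇒m<1+n k<n)))) (+-identityˡ 0#)

  sum-swap : ∀ m n (f : ℕ → ℕ → Carrier) →
    sumBelow m (λ i → sumBelow n (f i)) ≈ sumBelow n (λ j → sumBelow m (λ i → f i j))
  sum-swap zero    n f = sym (sum-zero n _ (λ _ _ → refl))
  sum-swap (suc m) n f = trans (+-congˡ (sum-swap m n f)) (sym (sum-+ n (f m) _))

  sum-single : ∀ n k (f : ℕ → Carrier) → k ℕ.< n → (∀ l → l ℕ.< n → ¬ (l ≡ k) → f l ≈ 0#) →
    sumBelow n f ≈ f k
  sum-single zero    k f () f≈0
  sum-single (suc n) k f k<1+n f≈0 with n ℕ.≟ k
  ... | yes P.refl = trans (+-congˡ (sum-zero n f below)) (+-identityʳ _)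
    where
    below : ∀ l → l ℕ.< n → f l ≈ 0#
    below l l<n = f≈0 l (ℕP.m<n⇒m<1+n l<n) (λ { P.refl → ℕP.<-irrefl P.refl l<n })
  ... | no n≢k = trans (+-congʳ (f≈0 n ℕP.≤-refl n≢k)) (trans (+-identityˡ _)
          (sum-single n k f k<n (λ l l<n → f≈0 l (ℕP.m<n⇒m<1+n l<n))))
    where
    k<n : k ℕ.< n
    k<n = ℕP.≤∧≢⇒< (ℕP.≤-pred k<1+n) (λ k≡n → n≢k (P.sym k≡n))

  sum-1# : ∀ n → sumBelow n (λ _ → 1#) ≈ ℕ→F n
  sum-1# zero    = refl
  sum-1# (suc n) = +-congˡ (sum-1# n)

  geometric-sum : ∀ x n → (x - 1#) * sumBelow n (pow x) ≈ pow x n - 1#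
  geometric-sum x zero = trans (zeroʳ _) (sym (-‿inverseʳ 1#))
  geometric-sum x (suc n) = begin
    (x - 1#) * (pow x n + sumBelow n (pow x))                ≈⟨ distribˡ _ _ _ ⟩
    (x - 1#) * pow x n + (x - 1#) * sumBelow n (pow x)       ≈⟨ +-cong ([x-y]z≈xz-yz _ _ _) (geometric-sum x n) ⟩
    (x * pow x n - 1# * pow x n) + (pow x n - 1#)            ≈⟨ +-congʳ (+-congˡ (-‿cong (*-identityˡ _))) ⟩
    (x * pow x n - pow x n) + (pow x n - 1#)                 ≈⟨ telescope _ _ _ ⟩
    x * pow x n - 1#                                         ∎

prime∤! : ∀ {p} → Prime p → ∀ m → m ℕ.< p → ¬ (p ∣ m !)
prime∤! pr zero    _   p∣1 = ¬prime[1] (P.subst Prime (∣1⇒≡1 p∣1) pr)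
prime∤! pr (suc m) m<p p∣m! with euclidsLemma (suc m) (m !) pr p∣m!
... | inj₁ p∣1+m = ℕP.<-irrefl P.refl (ℕP.≤-<-trans (∣⇒≤ p∣1+m) m<p)
... | inj₂ p∣m!  = prime∤! pr m (ℕP.<-trans (ℕP.n<1+n m) m<p) p∣m!

n∣n! : ∀ n → ℕ.NonZero n → n ∣ n !
n∣n! (suc n) _ = m∣m*n (n !)

-- A prime p divides the binomial coefficients p C k with 0 < k < p,
-- because (p C k) · k! · (p-k)! = p! and p divides neither k! nor (p-k)!.
prime∣binomial : ∀ {p k} → Prime p → 1 ℕ.≤ k → k ℕ.< p → p ∣ (p C k)
prime∣binomial {p} {k} pr 1≤k k<p with euclidsLemma (p C k) (k ! ℕ.* (p ℕ.∸ k) !) pr p∣product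
  where
  k≤p = ℕP.<⇒≤ k<p
  instance _ = k ℕP.!* (p ℕ.∸ k) !≢0
  p! : (p C k) ℕ.* (k ! ℕ.* (p ℕ.∸ k) !) ≡ p !
  p! = P.trans (P.cong (ℕ._* (k ! ℕ.* (p ℕ.∸ k) !)) (nCk≡n!/k![n-k]! k≤p)) (m/n*n≡m (k![n∸k]!∣n! k≤p))
  p∣product : p ∣ (p C k) ℕ.* (k ! ℕ.* (p ℕ.∸ k) !)
  p∣product = P.subst (p ∣_) (P.sym p!) (n∣n! p (ℕ.>-nonZero (ℕP.≤-<-trans ℕ.z≤n k<p)))
... | inj₁ p∣pCk = p∣pCk
... | inj₂ p∣k![p-k]! with euclidsLemma (k !) ((p ℕ.∸ k) !) pr p∣k![p-k]!
...   | inj₁ p∣k!     = ⊥-elim (prime∤! pr k k<p p∣k!)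
...   | inj₂ p∣[p-k]! = ⊥-elim (prime∤! pr (p ℕ.∸ k) (ℕP.∸-monoʳ-< {o = 0} 1≤k (ℕP.<⇒≤ k<p)) p∣[p-k]!)


-- A field admitting a primitive b-th root of unity (b ≥ 1) has ℕ→F b ≉ 0:
-- otherwise some prime p ∣ b vanishes in F, and for b = q·p the element ζ^q
-- satisfies (ζ^q - 1)^p = ζ^b - 1 = 0 by the Frobenius identity, so ζ^q = 1, with 1 ≤ q < b.
module Characteristic {c ℓ} (F : Field c ℓ) where
  open Field F
  open FieldOps F
  open FieldAlgebra F
  open import Relation.Binary.Reasoning.Setoid setoid
  open import Algebra.Properties.CommutativeSemiring.Binomial commutativeSemiring using (theorem)
  open import Algebra.Properties.Semiring.Exp semiring using (_^_)
  open import Algebra.Properties.Semiring.Mult semiring using (×-assoc-*; ×-congʳ; ×-congˡ) renaming (_×_ to _×ₙ_)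
  open import Algebra.Properties.Monoid.Sum +-monoid using (sum; sum-init-last; sum-cong-≋; sum-replicate-zero)

  -- Defs' pow agrees with the library's exponentiation, to which the binomial theorem applies.
  pow≈^ : ∀ x n → pow x n ≈ x ^ n
  pow≈^ x zero    = refl
  pow≈^ x (suc n) = *-congˡ (pow≈^ x n)

  ×-vanishing : ∀ n x → ℕ→F n ≈ 0# → n ×ₙ x ≈ 0#
  ×-vanishing n x n≈0 = begin
    n ×ₙ x          ≈⟨ ×-congʳ n (sym (*-identityˡ x)) ⟩
    n ×ₙ (1# * x)   ≈⟨ sym (×-assoc-* n 1# x) ⟩
    (n ×ₙ 1#) * x   ≈⟨ *-congʳ (trans (n×1≈ℕ→F n) n≈0) ⟩
    0# * x          ≈⟨ zeroˡ x ⟩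
    0#              ∎
    where
    n×1≈ℕ→F : ∀ n → n ×ₙ 1# ≈ ℕ→F n
    n×1≈ℕ→F zero    = refl
    n×1≈ℕ→F (suc n) = +-congˡ (n×1≈ℕ→F n)

  ℕ→F-∣ : ∀ {p m} → ℕ→F p ≈ 0# → p ∣ m → ℕ→F m ≈ 0#
  ℕ→F-∣ {p} p≈0 (divides q P.refl) = trans (ℕ→F-* q p) (trans (*-congˡ p≈0) (zeroʳ _))

  frobenius : ∀ {p} → Prime p → ℕ→F p ≈ 0# → ∀ y → pow (y + 1#) p ≈ pow y p + 1#
  frobenius {zero}   pr _   y = ⊥-elim (¬prime[0] pr)
  frobenius {suc p′} pr p≈0 y = begin
    pow (y + 1#) p                                    ≈⟨ pow≈^ _ p ⟩
    (y + 1#) ^ p                                      ≈⟨ theorem p y 1# ⟩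
    term 0 + sum {p} (λ k → term (toℕ (fsuc k)))      ≈⟨ +-cong term₀ (sum-init-last {p′} (λ k → term (toℕ (fsuc k)))) ⟩
    1# + (sum {p′} (λ i → term (suc (toℕ (inject₁ i)))) + term (suc (toℕ (fromℕ p′))))
      ≈⟨ +-congˡ (+-cong inner (reflexive (P.cong (λ j → term (suc j)) (toℕ-fromℕ p′)))) ⟩
    1# + (0# + term p)                                ≈⟨ +-congˡ (trans (+-identityˡ _) termₚ) ⟩
    1# + pow y p                                      ≈⟨ +-comm _ _ ⟩
    pow y p + 1#                                      ∎
    where
    p = suc p′
    term : ℕ → Carrier
    term j = (p C j) ×ₙ ((y ^ j) * (1# ^ (p ℕ.∸ j)))
    1^ : ∀ n → 1# ^ n ≈ 1#
    1^ n = trans (sym (pow≈^ 1# n)) (pow-1# n)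
    term₀ : term 0 ≈ 1#
    term₀ = begin
      (p C 0) ×ₙ ((y ^ 0) * (1# ^ p)) ≈⟨ ×-congˡ (P.trans (nCk≡nC[n∸k] {0} {p} ℕ.z≤n) (nCn≡1 p)) ⟩
      1 ×ₙ (1# * (1# ^ p))            ≈⟨ +-identityʳ _ ⟩
      1# * (1# ^ p)                   ≈⟨ *-identityˡ _ ⟩
      1# ^ p                          ≈⟨ 1^ p ⟩
      1#                              ∎
    termₚ : term p ≈ pow y p
    termₚ = begin
      (p C p) ×ₙ ((y ^ p) * (1# ^ (p ℕ.∸ p))) ≈⟨ ×-congˡ (nCn≡1 p) ⟩
      1 ×ₙ ((y ^ p) * (1# ^ (p ℕ.∸ p)))       ≈⟨ +-identityʳ _ ⟩
      (y ^ p) * (1# ^ (p ℕ.∸ p))              ≈⟨ *-congˡ (1^ (p ℕ.∸ p)) ⟩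
      (y ^ p) * 1#                            ≈⟨ *-identityʳ _ ⟩
      y ^ p                                   ≈⟨ sym (pow≈^ y p) ⟩
      pow y p                                 ∎
    -- the inner binomial coefficients are multiples of p
    inner : sum {p′} (λ i → term (suc (toℕ (inject₁ i)))) ≈ 0#
    inner = trans (sum-cong-≋ {p′} vanish) (sum-replicate-zero p′)
      where
      vanish : ∀ i → term (suc (toℕ (inject₁ i))) ≈ 0#
      vanish i = trans (reflexive (P.cong (λ j → term (suc j)) (toℕ-inject₁ i)))
        (×-vanishing (p C suc (toℕ i)) _ (ℕ→F-∣ p≈0 (prime∣binomial pr (ℕ.s≤s ℕ.z≤n) (ℕ.s≤s (toℕ<n i)))))

  prime-divisor-nonvanishing : ∀ {b ζ p} → .{{b≢0 : ℕ.NonZero b}} → IsPrimitiveRoot F b ζ →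
    Prime p → p ∣ b → ¬ (ℕ→F p ≈ 0#)
  prime-divisor-nonvanishing {b} {ζ} {p} {{b≢0}} (ζᵇ≈1 , ζᵏ≉1) pr (divides q b≡q*p) p≈0 =
    pow-nonzero p (≉⇒sub≉0 (ζᵏ≉1 q 1≤q q<b)) ηᵖ-1≈0
    where
    η = pow ζ q
    instance _ = ℕP.m*n≢0⇒m≢0 q {{P.subst ℕ.NonZero b≡q*p b≢0}}
    1≤q : 1 ℕ.≤ q
    1≤q = ℕ.>-nonZero⁻¹ q
    q<b : q ℕ.< b
    q<b = P.subst (q ℕ.<_) (P.sym b≡q*p) (ℕP.m<m*n q p (ℕ.nonTrivial⇒n>1 p {{prime⇒nonTrivial pr}}))
    ηᵖ≈1 : pow η p ≈ 1#
    ηᵖ≈1 = trans (sym (pow-* ζ q p)) (trans (reflexive (P.cong (pow ζ) (P.trans (ℕP.*-comm p q) (P.sym b≡q*p)))) ζᵇ≈1)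
    ηᵖ-1≈0 : pow (η - 1#) p ≈ 0#
    ηᵖ-1≈0 = ∙-cancelʳ 1# _ _ (begin
      pow (η - 1#) p + 1#  ≈⟨ sym (frobenius pr p≈0 (η - 1#)) ⟩
      pow (η - 1# + 1#) p  ≈⟨ pow-cong p (//-rightDividesˡ 1# η) ⟩
      pow η p              ≈⟨ ηᵖ≈1 ⟩
      1#                   ≈⟨ sym (+-identityˡ 1#) ⟩
      0# + 1#              ∎)

  -- The order b of a primitive root of unity does not vanish in F: every product
  -- of prime divisors of b is a product of nonvanishing factors.
  primitiveRoot⇒order≉0 : ∀ {b ζ} → .{{ℕ.NonZero b}} → IsPrimitiveRoot F b ζ → ¬ (ℕ→F b ≈ 0#)
  primitiveRoot⇒order≉0 {b} prim =
    P.subst (λ n → ¬ (ℕ→F n ≈ 0#)) (P.sym isFactorisation)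
      (product-nonvanishing factors factorsPrime (P.subst (_∣ b) isFactorisation ∣-refl))
    where
    open PrimeFactorisation (factorise b)
    product-nonvanishing : ∀ ps → ListAll.All Prime ps → product ps ∣ b → ¬ (ℕ→F (product ps) ≈ 0#)
    product-nonvanishing []       []         _      = λ 1≈0 → 1≉0 (trans (sym (+-identityʳ 1#)) 1≈0)
    product-nonvanishing (p ∷ ps) (pr ∷ prs) p·ps∣b p·ps≈0 =
      *-nonzero (prime-divisor-nonvanishing prim pr (∣-trans (m∣m*n (product ps)) p·ps∣b))
                (product-nonvanishing ps prs (∣-trans (n∣m*n p) p·ps∣b))
                (trans (sym (ℕ→F-* p (product ps))) p·ps≈0)

module RootsOfUnity {c ℓ} (F : Field c ℓ) (ζ : Field.Carrier F) (b : ℕ) .{{b≢0 : ℕ.NonZero b}}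
                    (prim : IsPrimitiveRoot F b ζ) where
  open Field F
  open FieldOps F
  open FieldAlgebra F
  open import Relation.Binary.Reasoning.Setoid setoid

  ζᵇ≈1 : pow ζ b ≈ 1#
  ζᵇ≈1 = proj₁ prim

  pow-multiple : ∀ q → pow ζ (q ℕ.* b) ≈ 1#
  pow-multiple q = trans (pow-* ζ b q) (trans (pow-cong q ζᵇ≈1) (pow-1# q))

  pow-∣ : ∀ {n} → b ∣ n → pow ζ n ≈ 1#
  pow-∣ (divides q P.refl) = pow-multiple q

  pow-∤ : ∀ {n} → ¬ (b ∣ n) → ¬ (pow ζ n ≈ 1#)
  pow-∤ {n} b∤n ζⁿ≈1 = proj₂ prim (n % b) 1≤n%b (m%n<n n b) ζ^[n%b]≈1
    where
    1≤n%b : 1 ℕ.≤ n % b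
    1≤n%b = ℕP.n≢0⇒n>0 (λ n%b≡0 → b∤n (m%n≡0⇒n∣m n b n%b≡0))
    ζ^[n%b]≈1 : pow ζ (n % b) ≈ 1#
    ζ^[n%b]≈1 = begin
      pow ζ (n % b)                          ≈⟨ sym (*-identityʳ _) ⟩
      pow ζ (n % b) * 1#                     ≈⟨ *-congˡ (sym (pow-multiple (n / b))) ⟩
      pow ζ (n % b) * pow ζ ((n / b) ℕ.* b)  ≈⟨ sym (pow-+ ζ (n % b) _) ⟩
      pow ζ (n % b ℕ.+ (n / b) ℕ.* b)        ≈⟨ reflexive (P.cong (pow ζ) (P.sym (m≡m%n+[m/n]*n n b))) ⟩
      pow ζ n                                ≈⟨ ζⁿ≈1 ⟩
      1#                                     ∎

  e : ℤ → Carrier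
  e = zpow ζ

  lift : ∀ z → Σ[ N ∈ ℕ ] Σ[ m ∈ ℕ ] z ℤ.+ + (N ℕ.* b) ≡ + m
  lift (+ n)    = 0 , n , P.cong +_ (ℕP.+-identityʳ n)
  lift -[1+ n ] = suc n , (suc n ℕ.* b ℕ.∸ suc n) , ℤP.⊖-≥ (ℕP.m≤m*n (suc n) b)

  e-lift : ∀ z N m → z ℤ.+ + (N ℕ.* b) ≡ + m → e z ≈ pow ζ m
  e-lift (+ n) N m eq = begin
    pow ζ n                         ≈⟨ sym (*-identityʳ _) ⟩
    pow ζ n * 1#                    ≈⟨ *-congˡ (sym (pow-multiple N)) ⟩
    pow ζ n * pow ζ (N ℕ.* b)       ≈⟨ sym (pow-+ ζ n _) ⟩
    pow ζ (n ℕ.+ N ℕ.* b)           ≡⟨ P.cong (pow ζ) (ℤP.+-injective eq) ⟩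
    pow ζ m                         ∎
  e-lift -[1+ n ] N m eq = ⁻¹-unique (begin
    pow ζ (suc n) * pow ζ m         ≈⟨ sym (pow-+ ζ (suc n) m) ⟩
    pow ζ (suc n ℕ.+ m)             ≡⟨ P.cong (pow ζ) (P.trans (ℕP.+-comm (suc n) m) m+1+n≡N*b) ⟩
    pow ζ (N ℕ.* b)                 ≈⟨ pow-multiple N ⟩
    1#                              ∎)
    where
    open AbelianGroupProperties ℤP.+-0-abelianGroup using (xyx⁻¹≈y)
    m+1+n≡N*b : m ℕ.+ suc n ≡ N ℕ.* b
    m+1+n≡N*b = ℤP.+-injective (P.trans (P.cong (ℤ._+ + suc n) (P.sym eq)) (xyx⁻¹≈y -[1+ n ] _))

  e-+ : ∀ x y → e (x ℤ.+ y) ≈ e x * e y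
  e-+ x y with lift x | lift y
  ... | N₁ , m₁ , eq₁ | N₂ , m₂ , eq₂ = begin
    e (x ℤ.+ y)      ≈⟨ e-lift (x ℤ.+ y) (N₁ ℕ.+ N₂) (m₁ ℕ.+ m₂) eq ⟩
    pow ζ (m₁ ℕ.+ m₂) ≈⟨ pow-+ ζ m₁ m₂ ⟩
    pow ζ m₁ * pow ζ m₂ ≈⟨ sym (*-cong (e-lift x N₁ m₁ eq₁) (e-lift y N₂ m₂ eq₂)) ⟩
    e x * e y        ∎
    where
    open CommSemigroupProperties ℤP.+-commutativeSemigroup using (interchange)
    eq : (x ℤ.+ y) ℤ.+ + ((N₁ ℕ.+ N₂) ℕ.* b) ≡ + (m₁ ℕ.+ m₂)
    eq = P.trans (P.cong (λ w → (x ℤ.+ y) ℤ.+ w) (P.trans (P.cong +_ (ℕP.*-distribʳ-+ b N₁ N₂)) (ℤP.pos-+ (N₁ ℕ.* b) (N₂ ℕ.* b))))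
           (P.trans (interchange x y (+ (N₁ ℕ.* b)) (+ (N₂ ℕ.* b)))
           (P.trans (P.cong₂ ℤ._+_ eq₁ eq₂) (P.sym (ℤP.pos-+ m₁ m₂))))

  e-neg : ∀ k k′ q → k ℕ.+ k′ ≡ q ℕ.* b → e (ℤ.- (+ k)) ≈ pow ζ k′
  e-neg k k′ q k+k′≡qb = trans (sym (⁻¹-unique ζᵏe[-k]≈1)) (⁻¹-unique ζᵏζᵏ′≈1)
    where
    ζᵏe[-k]≈1 : pow ζ k * e (ℤ.- (+ k)) ≈ 1#
    ζᵏe[-k]≈1 = trans (*-comm _ _) (trans (sym (e-+ (ℤ.- (+ k)) (+ k))) (reflexive (P.cong e (ℤP.+-inverseˡ (+ k)))))
    ζᵏζᵏ′≈1 : pow ζ k * pow ζ k′ ≈ 1#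
    ζᵏζᵏ′≈1 = trans (sym (pow-+ ζ k k′)) (trans (reflexive (P.cong (pow ζ) k+k′≡qb)) (pow-multiple q))

  e-shift : ∀ J n a → e (+ J ℤ.* (n ℤ.+ + a)) ≈ e (+ J ℤ.* n) * pow ζ (J ℕ.* a)
  e-shift J n a = begin
    e (+ J ℤ.* (n ℤ.+ + a))              ≡⟨ P.cong e (P.trans (ℤP.*-distribˡ-+ (+ J) n (+ a)) (P.cong (λ w → + J ℤ.* n ℤ.+ w) (P.sym (ℤP.pos-* J a)))) ⟩
    e (+ J ℤ.* n ℤ.+ + (J ℕ.* a))        ≈⟨ e-+ (+ J ℤ.* n) (+ (J ℕ.* a)) ⟩
    e (+ J ℤ.* n) * pow ζ (J ℕ.* a)      ∎

  e-reflect : ∀ J L t m → J ℕ.≤ b →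
    e (+ J ℤ.* (t ℤ.- + m)) * pow ζ (L ℕ.* m) ≈ e (+ J ℤ.* t) * pow (pow ζ (L ℕ.+ (b ℕ.∸ J))) m
  e-reflect J L t m J≤b = begin
    e (+ J ℤ.* (t ℤ.- + m)) * pow ζ (L ℕ.* m)
      ≡⟨ P.cong (λ z → e z * pow ζ (L ℕ.* m)) J[t-m]≡Jt-Jm ⟩
    e (+ J ℤ.* t ℤ.+ ℤ.- (+ (J ℕ.* m))) * pow ζ (L ℕ.* m)
      ≈⟨ *-congʳ (e-+ (+ J ℤ.* t) (ℤ.- (+ (J ℕ.* m)))) ⟩
    (e (+ J ℤ.* t) * e (ℤ.- (+ (J ℕ.* m)))) * pow ζ (L ℕ.* m)
      ≈⟨ *-assoc _ _ _ ⟩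
    e (+ J ℤ.* t) * (e (ℤ.- (+ (J ℕ.* m))) * pow ζ (L ℕ.* m))
      ≈⟨ *-congˡ (*-congʳ (e-neg (J ℕ.* m) ((b ℕ.∸ J) ℕ.* m) m Jm+[b-J]m≡mb)) ⟩
    e (+ J ℤ.* t) * (pow ζ ((b ℕ.∸ J) ℕ.* m) * pow ζ (L ℕ.* m))
      ≈⟨ *-congˡ (sym (pow-+ ζ ((b ℕ.∸ J) ℕ.* m) (L ℕ.* m))) ⟩
    e (+ J ℤ.* t) * pow ζ ((b ℕ.∸ J) ℕ.* m ℕ.+ L ℕ.* m)
      ≡⟨ P.cong (λ k → e (+ J ℤ.* t) * pow ζ k) [b-J]m+Lm≡m[L+b-J] ⟩
    e (+ J ℤ.* t) * pow ζ (m ℕ.* (L ℕ.+ (b ℕ.∸ J)))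
      ≈⟨ *-congˡ (pow-* ζ _ m) ⟩
    e (+ J ℤ.* t) * pow (pow ζ (L ℕ.+ (b ℕ.∸ J))) m ∎
    where
    J[t-m]≡Jt-Jm : + J ℤ.* (t ℤ.- + m) ≡ + J ℤ.* t ℤ.+ ℤ.- (+ (J ℕ.* m))
    J[t-m]≡Jt-Jm = P.trans (ℤP.*-distribˡ-+ (+ J) t (ℤ.- (+ m)))
      (P.cong (λ w → + J ℤ.* t ℤ.+ w) (P.trans (P.sym (ℤP.neg-distribʳ-* (+ J) (+ m))) (P.cong ℤ.-_ (P.sym (ℤP.pos-* J m)))))
    Jm+[b-J]m≡mb : J ℕ.* m ℕ.+ (b ℕ.∸ J) ℕ.* m ≡ m ℕ.* b
    Jm+[b-J]m≡mb = P.trans (P.sym (ℕP.*-distribʳ-+ m J (b ℕ.∸ J)))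
      (P.trans (P.cong (ℕ._* m) (ℕP.m+[n∸m]≡n J≤b)) (ℕP.*-comm b m))
    [b-J]m+Lm≡m[L+b-J] : (b ℕ.∸ J) ℕ.* m ℕ.+ L ℕ.* m ≡ m ℕ.* (L ℕ.+ (b ℕ.∸ J))
    [b-J]m+Lm≡m[L+b-J] = P.trans (ℕP.+-comm ((b ℕ.∸ J) ℕ.* m) (L ℕ.* m))
      (P.trans (P.sym (ℕP.*-distribʳ-+ m L (b ℕ.∸ J))) (ℕP.*-comm (L ℕ.+ (b ℕ.∸ J)) m))

  power-sum-∣ : ∀ {D} → b ∣ D → sumBelow b (pow (pow ζ D)) ≈ ℕ→F b
  power-sum-∣ b∣D = trans (sum-cong b (λ m _ → trans (pow-cong m (pow-∣ b∣D)) (pow-1# m))) (sum-1# b)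

  power-sum-∤ : ∀ {D} → ¬ (b ∣ D) → sumBelow b (pow (pow ζ D)) ≈ 0#
  power-sum-∤ {D} b∤D = cancel-nonzero (≉⇒sub≉0 (pow-∤ b∤D)) (begin
    (pow ζ D - 1#) * sumBelow b (pow (pow ζ D))  ≈⟨ geometric-sum (pow ζ D) b ⟩
    pow (pow ζ D) b - 1#                         ≈⟨ x≈y⇒x∙y⁻¹≈ε (trans (sym (pow-* ζ D b)) (pow-∣ (m∣m*n D))) ⟩
    0#                                           ∎)

  denominator : ∀ {d} → ℕ → Vec ℕ d → Carrier
  denominator J as = prodVec (map (λ a → 1# - pow ζ (J ℕ.* a)) as)

  -- Each factor 1 - ζ^{Ja} is nonzero for 1 ≤ J < b and a coprime to b, as then b ∤ Ja.
  denominator-factor-nonzero : ∀ {J a} → 1 ℕ.≤ J → J ℕ.< b → Coprime a b → ¬ (1# - pow ζ (J ℕ.* a) ≈ 0#)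
  denominator-factor-nonzero {J} {a} 1≤J J<b a⊥b = ≉⇒sub≉0 (λ 1≈ζᴶᵃ → pow-∤ b∤Ja (sym 1≈ζᴶᵃ))
    where
    b∤Ja : ¬ (b ∣ J ℕ.* a)
    b∤Ja b∣Ja = ℕP.<⇒≱ J<b (∣⇒≤ {{ℕ.>-nonZero 1≤J}} (coprime-divisor (Coprimality.sym a⊥b) (P.subst (b ∣_) (ℕP.*-comm J a) b∣Ja)))

  denominator-nonzero : ∀ {d J} {as : Vec ℕ d} → 1 ℕ.≤ J → J ℕ.< b → All (λ a → Coprime a b) as →
    ¬ (denominator J as ≈ 0#)
  denominator-nonzero 1≤J J<b []           = 1≉0
  denominator-nonzero 1≤J J<b (a⊥b ∷ as⊥b) =
    *-nonzero (denominator-factor-nonzero 1≤J J<b a⊥b) (denominator-nonzero 1≤J J<b as⊥b)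

-- For frequencies 1 ≤ L < b and J ≤ b:  b ∣ L + (b - J)  forces  L = J,
-- since 0 < L + (b - J) < 2b.
reflected-frequency-∤ : ∀ {b J L} → 1 ℕ.≤ L → L ℕ.< b → J ℕ.≤ b → ¬ (L ≡ J) → ¬ (b ∣ L ℕ.+ (b ℕ.∸ J))
reflected-frequency-∤ {b} {J} {L} 1≤L L<b J≤b L≢J (divides zero D≡0) =
  ℕP.<⇒≢ 1≤L (P.sym (ℕP.m+n≡0⇒m≡0 L D≡0))
reflected-frequency-∤ {b} {J} {L} 1≤L L<b J≤b L≢J (divides (suc zero) D≡b+0) =
  L≢J (ℕP.+-cancelʳ-≡ (b ℕ.∸ J) L J (P.trans D≡b+0 (P.trans (ℕP.+-identityʳ b) (P.sym (ℕP.m+[n∸m]≡n J≤b)))))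
reflected-frequency-∤ {b} {J} {L} 1≤L L<b J≤b L≢J (divides (suc (suc q)) D≡[2+q]b) =
  ℕP.<⇒≱ (ℕP.+-mono-<-≤ L<b (ℕP.m∸n≤m b J))
    (P.subst (b ℕ.+ b ℕ.≤_) (P.sym D≡[2+q]b) (ℕP.+-monoʳ-≤ b (ℕP.m≤m+n b (q ℕ.* b))))

module FourierSeries {c ℓ} (F : Field c ℓ) (ζ : Field.Carrier F) (b : ℕ) .{{b≢0 : ℕ.NonZero b}}
                     (prim : IsPrimitiveRoot F b ζ) where
  open Field F
  open FieldOps F
  open FieldAlgebra F
  open RootsOfUnity F ζ b prim
  open FourierDedekind F ζ b
  open import Relation.Binary.Reasoning.Setoid setoid

  -- 1/b; it exists because b does not vanish in F.
  β : Carrier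
  β = ℕ→F b ⁻¹

  β*b≈1 : β * ℕ→F b ≈ 1#
  β*b≈1 = inverseˡ (Characteristic.primitiveRoot⇒order≉0 F prim)

  -- The index k < b - 1 stands for the frequency J = k + 1, so 1 ≤ J < b.
  frequency<b : ∀ {k} → k ℕ.< b ℕ.∸ 1 → suc k ℕ.< b
  frequency<b k<b-1 = P.subst (ℕ._≤_ (suc (suc _))) (ℕP.m+[n∸m]≡n (ℕ.>-nonZero⁻¹ b)) (ℕ.s≤s k<b-1)

  series : (ℕ → Carrier) → ℤ → Carrier
  series c x = β * sumBelow (b ℕ.∸ 1) (λ k → e (+ suc k ℤ.* x) * c k)

  series-cong : ∀ {c c′} → (∀ k → k ℕ.< b ℕ.∸ 1 → c k ≈ c′ k) → series c ≋ series c′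
  series-cong c≈c′ x = *-congˡ (sum-cong (b ℕ.∸ 1) (λ k k< → *-congˡ (c≈c′ k k<)))

  series-difference : ∀ a c → IminusT a (series c) ≋ series (λ k → c k * (1# - pow ζ (suc k ℕ.* a)))
  series-difference a c x = begin
    β * sumBelow (b ℕ.∸ 1) (term x) - β * sumBelow (b ℕ.∸ 1) (term (x ℤ.+ + a))
      ≈⟨ sym (x[y-z]≈xy-xz β _ _) ⟩
    β * (sumBelow (b ℕ.∸ 1) (term x) - sumBelow (b ℕ.∸ 1) (term (x ℤ.+ + a)))
      ≈⟨ *-congˡ (sym (sum-sub (b ℕ.∸ 1) (term x) (term (x ℤ.+ + a)))) ⟩
    β * sumBelow (b ℕ.∸ 1) (λ k → term x k - term (x ℤ.+ + a) k)
      ≈⟨ *-congˡ (sum-cong (b ℕ.∸ 1) (λ k _ → term-difference k)) ⟩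
    series (λ k → c k * (1# - pow ζ (suc k ℕ.* a))) x ∎
    where
    term : ℤ → ℕ → Carrier
    term y k = e (+ suc k ℤ.* y) * c k
    term-difference : ∀ k → term x k - term (x ℤ.+ + a) k ≈ e (+ suc k ℤ.* x) * (c k * (1# - pow ζ (suc k ℕ.* a)))
    term-difference k = begin
      E * c k - e (+ suc k ℤ.* (x ℤ.+ + a)) * c k  ≈⟨ +-congˡ (-‿cong (*-congʳ (e-shift (suc k) x a))) ⟩
      E * c k - (E * z) * c k                     ≈⟨ +-congˡ (-‿cong (*P.xy∙z≈xz∙y E z (c k))) ⟩
      E * c k - (E * c k) * z                     ≈⟨ +-congʳ (sym (*-identityʳ _)) ⟩
      (E * c k) * 1# - (E * c k) * z              ≈⟨ sym (x[y-z]≈xy-xz _ 1# z) ⟩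
      (E * c k) * (1# - z)                        ≈⟨ *-assoc E (c k) _ ⟩
      E * (c k * (1# - z))                        ∎
      where
      E = e (+ suc k ℤ.* x)
      z = pow ζ (suc k ℕ.* a)

  -- Convolution of series multiplies coefficients: expanding the product gives
  -- a triple sum whose inner sum over m is, by orthogonality, b times a Kronecker delta.
  series-convolution : ∀ c c′ → (series c ⊛ series c′) ≋ series (λ k → c k * c′ k)
  series-convolution c c′ t = begin
    sumBelow b (λ m → series c (t ℤ.- + m) * series c′ (+ m))
      ≈⟨ sum-cong b (λ m _ → product-of-series m) ⟩
    sumBelow b (λ m → (β * β) * sumBelow n₁ (λ k → sumBelow n₁ (X m k)))
      ≈⟨ sym (*-sum b (β * β) _) ⟩
    (β * β) * sumBelow b (λ m → sumBelow n₁ (λ k → sumBelow n₁ (X m k)))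
      ≈⟨ *-congˡ (sum-swap b n₁ _) ⟩
    (β * β) * sumBelow n₁ (λ k → sumBelow b (λ m → sumBelow n₁ (X m k)))
      ≈⟨ *-congˡ (sum-cong n₁ (λ k _ → sum-swap b n₁ (λ m → X m k))) ⟩
    (β * β) * sumBelow n₁ (λ k → sumBelow n₁ (λ l → sumBelow b (λ m → X m k l)))
      ≈⟨ *-congˡ (sum-cong n₁ frequency-sum) ⟩
    (β * β) * sumBelow n₁ (λ k → W k * ℕ→F b)
      ≈⟨ *-congˡ (sym (sum-* n₁ (ℕ→F b) W)) ⟩
    (β * β) * (sumBelow n₁ W * ℕ→F b)
      ≈⟨ *P.interchange β β _ _ ⟩
    (β * sumBelow n₁ W) * (β * ℕ→F b)
      ≈⟨ *-congˡ β*b≈1 ⟩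
    (β * sumBelow n₁ W) * 1#
      ≈⟨ *-identityʳ _ ⟩
    series (λ k → c k * c′ k) t ∎
    where
    n₁ = b ℕ.∸ 1
    A : ℕ → ℕ → Carrier
    A m k = e (+ suc k ℤ.* (t ℤ.- + m)) * c k
    B : ℕ → ℕ → Carrier
    B m l = e (+ suc l ℤ.* + m) * c′ l
    X : ℕ → ℕ → ℕ → Carrier
    X m k l = A m k * B m l
    P : ℕ → ℕ → Carrier
    P k l = e (+ suc k ℤ.* t) * (c k * c′ l)
    W : ℕ → Carrier
    W k = P k k
    O : ℕ → ℕ → Carrier
    O k l = sumBelow b (pow (pow ζ (suc l ℕ.+ (b ℕ.∸ suc k))))

    product-of-series : ∀ m → series c (t ℤ.- + m) * series c′ (+ m) ≈ (β * β) * sumBelow n₁ (λ k → sumBelow n₁ (X m k))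
    product-of-series m = trans (*P.interchange β _ β _) (*-congˡ (sum-*-sum n₁ n₁ (A m) (B m)))

    reflected-term : ∀ k l m → k ℕ.< n₁ → X m k l ≈ P k l * pow (pow ζ (suc l ℕ.+ (b ℕ.∸ suc k))) m
    reflected-term k l m k< = begin
      (Eₖ * c k) * (e (+ suc l ℤ.* + m) * c′ l)
        ≈⟨ *P.interchange _ _ _ _ ⟩
      (Eₖ * e (+ suc l ℤ.* + m)) * (c k * c′ l)
        ≡⟨ P.cong (λ z → (Eₖ * e z) * (c k * c′ l)) (P.sym (ℤP.pos-* (suc l) m)) ⟩
      (Eₖ * pow ζ (suc l ℕ.* m)) * (c k * c′ l)
        ≈⟨ *-congʳ (e-reflect (suc k) (suc l) t m (ℕP.<⇒≤ (frequency<b k<))) ⟩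
      (e (+ suc k ℤ.* t) * pow (pow ζ (suc l ℕ.+ (b ℕ.∸ suc k))) m) * (c k * c′ l)
        ≈⟨ *P.xy∙z≈xz∙y _ _ _ ⟩
      P k l * pow (pow ζ (suc l ℕ.+ (b ℕ.∸ suc k))) m ∎
      where
      Eₖ = e (+ suc k ℤ.* (t ℤ.- + m))

    frequency-sum : ∀ k → k ℕ.< n₁ → sumBelow n₁ (λ l → sumBelow b (λ m → X m k l)) ≈ W k * ℕ→F b
    frequency-sum k k< = begin
      sumBelow n₁ (λ l → sumBelow b (λ m → X m k l))
        ≈⟨ sum-cong n₁ (λ l _ → trans (sum-cong b (λ m _ → reflected-term k l m k<)) (sym (*-sum b (P k l) _))) ⟩
      sumBelow n₁ (λ l → P k l * O k l)
        ≈⟨ sum-single n₁ k _ k< off-diagonal ⟩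
      W k * O k k
        ≈⟨ *-congˡ (power-sum-∣ (P.subst (b ∣_) (P.sym (ℕP.m+[n∸m]≡n (ℕP.<⇒≤ (frequency<b k<)))) ∣-refl)) ⟩
      W k * ℕ→F b ∎
      where
      off-diagonal : ∀ l → l ℕ.< n₁ → ¬ (l ≡ k) → P k l * O k l ≈ 0#
      off-diagonal l l< l≢k = trans (*-congˡ (power-sum-∤ b∤D)) (zeroʳ _)
        where
        b∤D = reflected-frequency-∤ (ℕ.s≤s ℕ.z≤n) (frequency<b l<) (ℕP.<⇒≤ (frequency<b k<)) (λ 1+l≡1+k → l≢k (ℕP.suc-injective 1+l≡1+k))

All-init : ∀ {a p} {A : Set a} {P : A → Set p} {d} (xs : Vec A (suc d)) → All P xs → All P (init xs)
All-init (x ∷ [])     (px ∷ [])  = []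
All-init (x ∷ y ∷ xs) (px ∷ pxs) = px ∷ All-init (y ∷ xs) pxs

All-last : ∀ {a p} {A : Set a} {P : A → Set p} {d} (xs : Vec A (suc d)) → All P xs → P (last xs)
All-last (x ∷ [])     (px ∷ [])  = px
All-last (x ∷ y ∷ xs) (px ∷ pxs) = All-last (y ∷ xs) pxs

module FourierDedekindSums {c ℓ} (F : Field c ℓ) (ζ : Field.Carrier F) (b : ℕ) .{{b≢0 : ℕ.NonZero b}}
                           (prim : IsPrimitiveRoot F b ζ) where
  open Field F
  open FieldOps F
  open FieldAlgebra F
  open RootsOfUnity F ζ b prim
  open FourierSeries F ζ b prim
  open FourierDedekind F ζ b
  open import Relation.Binary.Reasoning.Setoid setoid

  -- By definition S_{(as;b)} = series (coefficient as): its J-th coefficient is 1 / ∏ (1 - ζ^{J a}).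
  coefficient : ∀ {d} → Vec ℕ d → ℕ → Carrier
  coefficient as k = denominator (suc k) as ⁻¹

  difference-equation : ∀ {d} (as : Vec ℕ (suc d)) → All (λ a → Coprime a b) as →
    IminusT (last as) (S as) ≋ S (init as)
  difference-equation as as⊥b x = begin
    IminusT (last as) (series (coefficient as)) x                              ≈⟨ series-difference (last as) (coefficient as) x ⟩
    series (λ k → coefficient as k * (1# - pow ζ (suc k ℕ.* last as))) x        ≈⟨ series-cong peel x ⟩
    series (coefficient (init as)) x                                           ∎
    where
    -- the factor 1 - ζ^{J a_d} cancels the last factor of the denominator
    peel : ∀ k → k ℕ.< b ℕ.∸ 1 → coefficient as k * (1# - pow ζ (suc k ℕ.* last as)) ≈ coefficient (init as) k
    peel k k< = begin
      D ⁻¹ * y           ≈⟨ *-congʳ (⁻¹-cong D≉0 (prodVec-init-last (λ a → 1# - pow ζ (suc k ℕ.* a)) as)) ⟩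
      (Q * y) ⁻¹ * y     ≈⟨ *-congʳ (⁻¹-* Q≉0 y≉0) ⟩
      (Q ⁻¹ * y ⁻¹) * y  ≈⟨ *-assoc _ _ _ ⟩
      Q ⁻¹ * (y ⁻¹ * y)  ≈⟨ *-congˡ (inverseˡ y≉0) ⟩
      Q ⁻¹ * 1#          ≈⟨ *-identityʳ _ ⟩
      Q ⁻¹               ∎
      where
      1≤J = ℕ.s≤s ℕ.z≤n
      J<b = frequency<b k<
      D = denominator (suc k) as
      Q = denominator (suc k) (init as)
      y = 1# - pow ζ (suc k ℕ.* last as)
      D≉0 = denominator-nonzero 1≤J J<b as⊥b
      Q≉0 = denominator-nonzero 1≤J J<b (All-init as as⊥b)
      y≉0 = denominator-factor-nonzero 1≤J J<b (All-last as as⊥b)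

  ⊛-congʳ : ∀ f {g g′} → g ≋ g′ → (f ⊛ g) ≋ (f ⊛ g′)
  ⊛-congʳ f g≋g′ t = sum-cong b (λ m _ → *-congˡ (g≋g′ (+ m)))

  convolution-decomposition : ∀ {d} (as : Vec ℕ (suc d)) → All (λ a → Coprime a b) as → S as ≋ convS as
  convolution-decomposition (a ∷ [])          _              x = refl
  convolution-decomposition (a ∷ a′ ∷ as) (a⊥b ∷ as⊥b) t = begin
    S (a ∷ a′ ∷ as) t                                 ≈⟨ series-cong split t ⟩
    series (λ k → coefficient (a ∷ []) k * coefficient (a′ ∷ as) k) t
                                                      ≈⟨ sym (series-convolution (coefficient (a ∷ [])) (coefficient (a′ ∷ as)) t) ⟩
    (S (a ∷ []) ⊛ S (a′ ∷ as)) t                      ≈⟨ ⊛-congʳ (S (a ∷ [])) (convolution-decomposition (a′ ∷ as) as⊥b) t ⟩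
    (S (a ∷ []) ⊛ convS (a′ ∷ as)) t                  ∎
    where
    split : ∀ k → k ℕ.< b ℕ.∸ 1 → coefficient (a ∷ a′ ∷ as) k ≈ coefficient (a ∷ []) k * coefficient (a′ ∷ as) k
    split k k< = begin
      (y * Q) ⁻¹          ≈⟨ ⁻¹-* y≉0 Q≉0 ⟩
      y ⁻¹ * Q ⁻¹         ≈⟨ *-congʳ (⁻¹-cong y≉0 (sym (*-identityʳ y))) ⟩
      (y * 1#) ⁻¹ * Q ⁻¹  ∎
      where
      1≤J = ℕ.s≤s ℕ.z≤n
      J<b = frequency<b k<
      y = 1# - pow ζ (suc k ℕ.* a)
      Q = denominator (suc k) (a′ ∷ as)
      y≉0 = denominator-factor-nonzero 1≤J J<b a⊥b
      Q≉0 = denominator-nonzero 1≤J J<b as⊥b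

-- The theorem: both identities hold for b ≥ 2 and a_i coprime to b.
theorem3 : ∀ {c ℓ} (F : Field c ℓ) (ζ : Field.Carrier F) (b : ℕ) → b ≥ 2 →
    IsPrimitiveRoot F b ζ →
    (d : ℕ) (as : Vec ℕ (suc d)) →
    All (λ a → 1 ≤ a × Coprime a b) as →
    (FourierDedekind._≋_ F ζ b (FourierDedekind.IminusT F ζ b (last as) (FourierDedekind.S F ζ b as)) (FourierDedekind.S F ζ b (init as)))
    × (FourierDedekind._≋_ F ζ b (FourierDedekind.S F ζ b as) (FourierDedekind.convS F ζ b as))
theorem3 F ζ b b≥2 prim d as hyps =
  difference-equation as as⊥b , convolution-decomposition as as⊥b
  where
  instance
    b≢0 : ℕ.NonZero b
    b≢0 = ℕ.>-nonZero (ℕP.<-≤-trans (ℕ.s≤s ℕ.z≤n) b≥2)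
  open FourierDedekindSums F ζ b prim
  as⊥b : All (λ a → Coprime a b) as
  as⊥b = All.map proj₂ hyps
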